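{- Define graphs $H_0,H_1,\dots$ recursively: $H_0$ is a single vertex; for $k\ge1$, $H_k$ consists of a complete graph $K_{2^{k+1}-1}$ with vertices numbered $1,\dots,2^{k+1}-1$, together with $2^{k+1}-1$ disjoint copies of $H_{k-1}$, where for each $i$ the $i$-th vertex of the clique is joined by an edge to one vertex of the $i$-th copy of $H_{k-1}$. Then for every $k\ge0$, $\chi_{um}(H_k)\ge 2^{k+2}-2k-3$.
   Context: A path is a simple path (a single vertex counts). A unique-maximum coloring of a graph with $k$ colors is a map from its vertices to $\{1,\dots,k\}$ such that on every path the maximum color occurs exactly once; $\chi_{um}$ is the minimum such $k$. -}

module Defs where

open import Data.Nat using (ℕ; zero; suc; _+_; _*_; _∸_; _^_)
open import Data.Fin using (Fin) renaming (_<_ to _<ᶠ_)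
open import Data.Unit using (⊤)
open import Data.Empty using (⊥)
open import Data.Sum using (_⊎_; inj₁; inj₂)
open import Data.Product using (Σ; _×_; _,_)
open import Data.List using (List; []; _∷_; length; lookup)
open import Data.List.Relation.Unary.Unique.Propositional using (Unique)
open import Data.List.Relation.Unary.Linked using (Linked)
open import Relation.Binary.PropositionalEquality using (_≡_; _≢_)
open import Relation.Nullary using (¬_)

-- size of the clique used to build H_(k+1): 2^(k+2) - 1
cliqueSize : ℕ → ℕ
cliqueSize k = 2 ^ (k + 2) ∸ 1

V : ℕ → Set
V zero    = ⊤
V (suc k) = Fin (cliqueSize k) ⊎ (Fin (cliqueSize k) × V k)
-- inj₁ i      : i-th clique vertex
-- inj₂ (i , v): vertex v of the i-th copy of H_k

-- The informal definition leaves open which vertex of the i-th copy is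
-- joined to the i-th clique vertex.  A "construction" of H_k records these
-- choices: a construction of H_(k-1) (all copies are copies of this one
-- graph) together with, for each i, the attachment vertex in copy i.
Construction : ℕ → Set
Construction zero    = ⊤
Construction (suc k) = Construction k × (Fin (cliqueSize k) → V k)

Adj : (k : ℕ) → Construction k → V k → V k → Set
Adj zero    _        _ _ = ⊥
Adj (suc k) (c , a) (inj₁ i)       (inj₁ j)       = i ≢ j
Adj (suc k) (c , a) (inj₁ i)       (inj₂ (j , v)) = (i ≡ j) × (v ≡ a j)
Adj (suc k) (c , a) (inj₂ (i , u)) (inj₁ j)       = (i ≡ j) × (u ≡ a i)
Adj (suc k) (c , a) (inj₂ (i , u)) (inj₂ (j , v)) = (i ≡ j) × Adj k c u v

IsPath : {A : Set} → (A → A → Set) → List A → Set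
IsPath E p = ¬ (p ≡ []) × Unique p × Linked E p

UniqueMaxOn : {A : Set} {n : ℕ} → (A → Fin n) → List A → Set
UniqueMaxOn f p =
  Σ (Fin (length p)) λ i → (j : Fin (length p)) → j ≢ i →
    f (lookup p j) <ᶠ f (lookup p i)

-- unique-maximum colouring with n colours (colours 1..n represented by Fin n)
IsUMColoring : {A : Set} → (A → A → Set) → {n : ℕ} → (A → Fin n) → Set
IsUMColoring E f = ∀ p → IsPath E p → UniqueMaxOn f p

-- Call the 2^(k+2) − 1 copies of H_k hanging off the clique of H_(k+1), each
-- together with its clique vertex, the blocks of H_(k+1).  Any two vertices in
-- different blocks lie on a common path inside those two blocks, so the unique
-- maximum of that path is strictly above the colour of one of them.  Starting
-- from one vertex of colour ≥ b in each block (induction on k, restricted to the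
-- copies) and playing these duels as a knock-out tournament among s + 1 blocks
-- gives a vertex of colour ≥ b + s.  Hence the bound grows by 2^(k+2) − 2 from
-- H_k to H_(k+1), which is exactly the recurrence of 2^(k+2) − 2k − 3.
module Submission where

open import Defs
open import Data.Nat using (ℕ; zero; suc; _+_; _*_; _∸_; _^_; _≤_; _<_; s≤s; z≤n)
open import Data.Nat.Properties
  using (≤-trans; ≤-reflexive; +-identityʳ; +-suc; m≤m+n; m≤n+m; *-monoʳ-≤;
         m≤n⇒∃[o]m+o≡n; n≤1+n; ∸-+-assoc; +-∸-assoc; m+n∸n≡m; m+n∸m≡n)
open import Data.Nat.Tactic.RingSolver using (solve-∀)
open import Data.Fin using (Fin; zero; suc; toℕ; punchIn; cast; _≟_) renaming (_<_ to _<ᶠ_)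
open import Data.Fin.Properties
  using (toℕ<n; suc-injective; punchIn-injective; punchInᵢ≢i; cast-involutive)
open import Data.Unit using (tt)
open import Data.Sum using (_⊎_; inj₁; inj₂; [_,_]′) renaming (map to ⊎-map)
open import Data.Product using (∃; _×_; _,_)
open import Data.List using (List; []; _∷_; length; lookup; map; _++_)
open import Data.List.Properties using (length-map)
open import Data.List.Relation.Unary.Unique.Propositional using (Unique)
import Data.List.Relation.Unary.Unique.Propositional.Properties as Unique
open import Data.List.Relation.Unary.AllPairs using ([]; _∷_)
open import Data.List.Relation.Unary.Linked using (Linked; [-]; _∷_)
import Data.List.Relation.Unary.Linked as Linked
import Data.List.Relation.Unary.Linked.Properties as Linked
open import Data.List.Relation.Unary.All using (All; []; _∷_)
import Data.List.Relation.Unary.All as All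
import Data.List.Relation.Unary.All.Properties as All
open import Data.List.Relation.Unary.Any using (here; there; index)
open import Data.List.Relation.Unary.Any.Properties using (lookup-index)
open import Data.List.Membership.Propositional using (_∈_)
open import Data.List.Membership.Propositional.Properties using (∈-lookup)
open import Function using (_∘_)
open import Function.Definitions using (Injective)
open import Relation.Binary.PropositionalEquality
open import Relation.Nullary using (yes; no; contradiction)
open import Relation.Unary using (Pred; U; _⊆_; _∪_; _⊥_)
open import Level using (0ℓ)

colour : {A : Set} {n : ℕ} → (A → Fin n) → A → ℕ
colour f v = suc (toℕ (f v))

data Walk {A : Set} (E : A → A → Set) : A → A → List A → Set where
  stop : ∀ {u} → Walk E u u (u ∷ [])
  step : ∀ {u w v xs} → E u w → Walk E w v xs → Walk E u v (u ∷ xs)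

module _ {A : Set} {E : A → A → Set} where

  walk-linked : ∀ {u v xs} → Walk E u v xs → Linked E xs
  walk-linked stop                 = [-]
  walk-linked (step e stop)        = e ∷ [-]
  walk-linked (step e (step e′ w)) = e ∷ walk-linked (step e′ w)

  walk-nonempty : ∀ {u v xs} → Walk E u v xs → xs ≢ []
  walk-nonempty stop       ()
  walk-nonempty (step _ _) ()

  walk-join : ∀ {u x y v xs ys} → Walk E u x xs → E x y → Walk E y v ys →
              Walk E u v (xs ++ ys)
  walk-join stop        e w′ = step e w′
  walk-join (step e′ w) e w′ = step e′ (walk-join w e w′)

  start∈ : ∀ {u v xs} → Walk E u v xs → u ∈ xs
  start∈ stop       = here refl
  start∈ (step _ _) = here refl

  end∈ : ∀ {u v xs} → Walk E u v xs → v ∈ xs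
  end∈ stop       = here refl
  end∈ (step _ w) = there (end∈ w)

walk-map : ∀ {A B : Set} {E : A → A → Set} {E′ : B → B → Set} (h : A → B) →
           (∀ {x y} → E x y → E′ (h x) (h y)) →
           ∀ {u v xs} → Walk E u v xs → Walk E′ (h u) (h v) (map h xs)
walk-map h h-edge stop       = stop
walk-map h h-edge (step e w) = step (h-edge e) (walk-map h h-edge w)

record PathIn {A : Set} (E : A → A → Set) (T : Pred A 0ℓ) (u v : A) : Set where
  field
    vertices : List A
    walk     : Walk E u v vertices
    unique   : Unique vertices
    inside   : All T vertices

  isPath : IsPath E vertices
  isPath = walk-nonempty walk , unique , walk-linked walk

module _ {A : Set} {E : A → A → Set} where

  pathIn-refl : ∀ {T u} → T u → PathIn E T u u
  pathIn-refl Tu = record { walk = stop ; unique = [] ∷ [] ; inside = Tu ∷ [] }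

  pathIn-weaken : ∀ {T S u v} → T ⊆ S → PathIn E T u v → PathIn E S u v
  pathIn-weaken T⊆S p = record { PathIn p ; inside = All.map T⊆S (PathIn.inside p) }

  pathIn-join : ∀ {T S u x y v} → PathIn E T u x → E x y → PathIn E S y v → T ⊥ S →
                PathIn E (T ∪ S) u v
  pathIn-join p e q T⊥S = record
    { walk   = walk-join (PathIn.walk p) e (PathIn.walk q)
    ; unique = Unique.++⁺ (PathIn.unique p) (PathIn.unique q) λ (z∈p , z∈q) →
                 T⊥S (All.lookup (PathIn.inside p) z∈p , All.lookup (PathIn.inside q) z∈q)
    ; inside = All.++⁺ (All.map inj₁ (PathIn.inside p)) (All.map inj₂ (PathIn.inside q))
    }

pathIn-map : ∀ {A B : Set} {E : A → A → Set} {E′ : B → B → Set} {T T′} (h : A → B) →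
             Injective _≡_ _≡_ h → (∀ {x y} → E x y → E′ (h x) (h y)) → (∀ x → T′ (h x)) →
             ∀ {u v} → PathIn E T u v → PathIn E′ T′ (h u) (h v)
pathIn-map h h-injective h-edge T′∘h p = record
  { walk   = walk-map h h-edge (PathIn.walk p)
  ; unique = Unique.map⁺ h-injective (PathIn.unique p)
  ; inside = All.map⁺ (All.tabulate λ {x} _ → T′∘h x)
  }

module _ {A : Set} {n : ℕ} (f : A → Fin n) where

  uniqueMax-∈ : ∀ {p} → UniqueMaxOn f p →
                ∃ λ x → x ∈ p × (∀ {y} → y ∈ p → y ≡ x ⊎ f y <ᶠ f x)
  uniqueMax-∈ {p} (m , above) =
    lookup p m , ∈-lookup m , λ y∈p → compare (index y∈p) (lookup-index y∈p)
    where
    compare : ∀ {y} j → y ≡ lookup p j → y ≡ lookup p m ⊎ f y <ᶠ f (lookup p m)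
    compare j refl with j ≟ m
    ... | yes refl = inj₁ refl
    ... | no j≢m   = inj₂ (above j j≢m)

  uniqueMax-above-one-of : ∀ {p u v} → UniqueMaxOn f p → u ∈ p → v ∈ p → u ≢ v →
                           ∃ λ x → x ∈ p × (f u <ᶠ f x ⊎ f v <ᶠ f x)
  uniqueMax-above-one-of um u∈p v∈p u≢v with uniqueMax-∈ um
  ... | x , x∈p , below with below u∈p | below v∈p
  ...   | inj₂ fu<fx | _          = x , x∈p , inj₁ fu<fx
  ...   | inj₁ _     | inj₂ fv<fx = x , x∈p , inj₂ fv<fx
  ...   | inj₁ refl  | inj₁ refl  = contradiction refl u≢v

module _ {A B : Set} (h : A → B) where

  lookup-map-cast : ∀ p (i : Fin (length (map h p))) →
                    lookup (map h p) i ≡ h (lookup p (cast (length-map h p) i))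
  lookup-map-cast (_ ∷ _) zero    = refl
  lookup-map-cast (_ ∷ p) (suc i) = lookup-map-cast p i

  uniqueMaxOn-map : ∀ {n} (f : B → Fin n) p → UniqueMaxOn f (map h p) → UniqueMaxOn (f ∘ h) p
  uniqueMaxOn-map f p (m , above) = to m , λ j j≢to-m → subst₂ (λ x y → f x <ᶠ f y)
      (trans (lookup-map-cast p (from j)) (cong (h ∘ lookup p) (to∘from j)))
      (lookup-map-cast p m)
      (above (from j) λ e → j≢to-m (trans (sym (to∘from j)) (cong to e)))
    where
    to : Fin (length (map h p)) → Fin (length p)
    to = cast (length-map h p)
    from : Fin (length p) → Fin (length (map h p))
    from = cast (sym (length-map h p))
    to∘from : ∀ j → to (from j) ≡ j
    to∘from = cast-involutive (length-map h p) (sym (length-map h p))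

  module _ {E : A → A → Set} {E′ : B → B → Set} (h-injective : Injective _≡_ _≡_ h)
           (h-edge : ∀ {x y} → E x y → E′ (h x) (h y)) where

    isPath-map : ∀ {p} → IsPath E p → IsPath E′ (map h p)
    isPath-map {[]}    (nonempty , _)        = contradiction refl nonempty
    isPath-map {_ ∷ _} (_ , unique , linked) =
      (λ ()) , Unique.map⁺ h-injective unique , Linked.map⁺ (Linked.map h-edge linked)

    isUMColoring-pullback : ∀ {n} {f : B → Fin n} → IsUMColoring E′ f → IsUMColoring E (f ∘ h)
    isUMColoring-pullback {f = f} um p path = uniqueMaxOn-map f p (um (map h p) (isPath-map path))

pathIn-above-one-of : ∀ {A : Set} {E : A → A → Set} {T n} {f : A → Fin n} {u v} →
                      IsUMColoring E f → PathIn E T u v → u ≢ v →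
                      ∃ λ x → T x × (colour f u < colour f x ⊎ colour f v < colour f x)
pathIn-above-one-of {f = f} um p u≢v
  with uniqueMax-above-one-of f (um vertices isPath) (start∈ walk) (end∈ walk) u≢v
  where open PathIn p
... | x , x∈p , above = x , All.lookup (PathIn.inside p) x∈p , ⊎-map s≤s s≤s above

injective-punchIn : ∀ {A : Set} {n} {g : Fin (suc n) → A} → Injective _≡_ _≡_ g →
                    ∀ i j → g i ≢ g (punchIn i j)
injective-punchIn g-injective i j e = punchInᵢ≢i i j (sym (g-injective e))

InBlock : {G : Set} {N : ℕ} → (G → Fin N) → Fin N → Pred G 0ℓ
InBlock block i z = block z ≡ i

module Tournament {G : Set} {N n : ℕ} {E : G → G → Set} (block : G → Fin N)
                  (f : G → Fin n) (um : IsUMColoring E f)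
                  (link : ∀ {u v} → block u ≢ block v →
                          PathIn E (InBlock block (block u) ∪ InBlock block (block v)) u v)
                  where

  duel : ∀ {u v} → block u ≢ block v →
         ∃ λ x → (block x ≡ block u ⊎ block x ≡ block v) ×
                 (colour f u < colour f x ⊎ colour f v < colour f x)
  duel u≢v = pathIn-above-one-of um (link u≢v) (u≢v ∘ cong block)

  -- The second sub-tournament avoids the block won by the first, so their winners duel.
  knockout : ∀ {b} → (∀ i → ∃ λ v → block v ≡ i × b ≤ colour f v) →
             ∀ s (g : Fin (suc s) → Fin N) → Injective _≡_ _≡_ g →
             ∃ λ v → (∃ λ r → block v ≡ g r) × b + s ≤ colour f v
  knockout {b} seeds zero g _ with seeds (g zero)
  ... | v , v∈g0 , b≤v = v , (zero , v∈g0) , ≤-trans (≤-reflexive (+-identityʳ b)) b≤v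
  knockout {b} seeds (suc s) g g-injective
    with knockout seeds s (g ∘ suc) (suc-injective ∘ g-injective)
  ... | w , (r , w∈gr) , b+s≤w
    with knockout seeds s (g ∘ punchIn (suc r)) (punchIn-injective (suc r) _ _ ∘ g-injective)
  ... | w′ , (r′ , w′∈gr′) , b+s≤w′
    with duel {w} {w′} (λ e →
           injective-punchIn g-injective (suc r) r′ (trans (sym w∈gr) (trans e w′∈gr′)))
  ... | x , x∈w∪w′ , above =
    x , [ (λ e → suc r , trans e w∈gr) , (λ e → punchIn (suc r) r′ , trans e w′∈gr′) ]′ x∈w∪w′
      , [ beats b+s≤w , beats b+s≤w′ ]′ above
    where
    beats : ∀ {y} → b + s ≤ colour f y → colour f y < colour f x → b + suc s ≤ colour f x
    beats b+s≤y y<x = ≤-trans (≤-reflexive (+-suc b s)) (≤-trans (s≤s b+s≤y) y<x)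

module Blocks (k : ℕ) (c : Construction k) (a : Fin (cliqueSize k) → V k)
              (connected : ∀ u v → PathIn (Adj k c) U u v) where

  E : V (suc k) → V (suc k) → Set
  E = Adj (suc k) (c , a)

  block : V (suc k) → Fin (cliqueSize k)
  block (inj₁ i)       = i
  block (inj₂ (i , _)) = i

  hub : Fin (cliqueSize k) → V (suc k)
  hub = inj₁

  copy : Fin (cliqueSize k) → V k → V (suc k)
  copy i u = inj₂ (i , u)

  copy-injective : ∀ i → Injective _≡_ _≡_ (copy i)
  copy-injective i refl = refl

  copy-edge : ∀ i {u v} → Adj k c u v → E (copy i u) (copy i v)
  copy-edge i e = refl , e

  IsHub : Fin (cliqueSize k) → Pred (V (suc k)) 0ℓ
  IsHub i z = z ≡ hub i

  InCopy : Fin (cliqueSize k) → Pred (V (suc k)) 0ℓ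
  InCopy i z = ∃ λ u → z ≡ copy i u

  InCopy⊥IsHub : ∀ i → InCopy i ⊥ IsHub i
  InCopy⊥IsHub i ((_ , refl) , ())

  IsHub⊥InCopy : ∀ i → IsHub i ⊥ InCopy i
  IsHub⊥InCopy i (refl , (_ , ()))

  IsHub∪InCopy⊆InBlock : ∀ i → IsHub i ∪ InCopy i ⊆ InBlock block i
  IsHub∪InCopy⊆InBlock i (inj₁ refl)       = refl
  IsHub∪InCopy⊆InBlock i (inj₂ (_ , refl)) = refl

  InCopy∪IsHub⊆InBlock : ∀ i → InCopy i ∪ IsHub i ⊆ InBlock block i
  InCopy∪IsHub⊆InBlock i = IsHub∪InCopy⊆InBlock i ∘ [ inj₂ , inj₁ ]′

  withinCopy : ∀ i u v → PathIn E (InCopy i) (copy i u) (copy i v)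
  withinCopy i u v = pathIn-map (copy i) (copy-injective i) (copy-edge i) (λ x → x , refl) (connected u v)

  toHub : ∀ z → PathIn E (InBlock block (block z)) z (hub (block z))
  toHub (inj₁ i)       = pathIn-refl refl
  toHub (inj₂ (i , u)) = pathIn-weaken (InCopy∪IsHub⊆InBlock i)
    (pathIn-join (withinCopy i u (a i)) (refl , refl) (pathIn-refl refl) (InCopy⊥IsHub i))

  fromHub : ∀ z → PathIn E (InBlock block (block z)) (hub (block z)) z
  fromHub (inj₁ i)       = pathIn-refl refl
  fromHub (inj₂ (i , v)) = pathIn-weaken (IsHub∪InCopy⊆InBlock i)
    (pathIn-join (pathIn-refl refl) (refl , refl) (withinCopy i (a i) v) (IsHub⊥InCopy i))

  acrossBlocks : ∀ {u v} → block u ≢ block v →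
                 PathIn E (InBlock block (block u) ∪ InBlock block (block v)) u v
  acrossBlocks {u} {v} u≢v =
    pathIn-join (toHub u) u≢v (fromHub v) λ (e , e′) → u≢v (trans (sym e) e′)

  connected-suc : ∀ u v → PathIn E U u v
  connected-suc u v with block u ≟ block v
  connected-suc u v                             | no u≢v   = pathIn-weaken _ (acrossBlocks u≢v)
  connected-suc (inj₁ i)       (inj₁ .i)        | yes refl = pathIn-refl tt
  connected-suc (inj₁ i)       (inj₂ (.i , v))  | yes refl = pathIn-weaken _ (fromHub (copy i v))
  connected-suc (inj₂ (i , u)) (inj₁ .i)        | yes refl = pathIn-weaken _ (toHub (copy i u))
  connected-suc (inj₂ (i , u)) (inj₂ (.i , v))  | yes refl = pathIn-weaken _ (withinCopy i u v)

connected : ∀ k c u v → PathIn (Adj k c) U u v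
connected zero    c       tt tt = pathIn-refl tt
connected (suc k) (c , a) u  v  = Blocks.connected-suc k c a (connected k c) u v

lowerBound : ℕ → ℕ
lowerBound k = 2 ^ (k + 2) ∸ 2 * k ∸ 3

2k+3≤2^[k+2] : ∀ k → 2 * k + 3 ≤ 2 ^ (k + 2)
2k+3≤2^[k+2] zero    = n≤1+n 3
2k+3≤2^[k+2] (suc k) = ≤-trans (≤-trans (m≤m+n _ (2 * k + 1)) (≤-reflexive (eq k)))
                               (*-monoʳ-≤ 2 (2k+3≤2^[k+2] k))
  where
  eq : ∀ k → 2 * suc k + 3 + (2 * k + 1) ≡ 2 * (2 * k + 3)
  eq = solve-∀

double-∸ : ∀ k {P} → 2 * k + 3 ≤ P → 2 * P ∸ 2 * suc k ∸ 3 ≡ (P ∸ 2 * k ∸ 3) + (P ∸ 2)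
double-∸ k le with m≤n⇒∃[o]m+o≡n le
... | d , refl = begin
  2 * P ∸ 2 * suc k ∸ 3                                   ≡⟨ ∸-+-assoc (2 * P) (2 * suc k) 3 ⟩
  2 * P ∸ (2 * suc k + 3)                                 ≡⟨ cong (_∸ (2 * suc k + 3)) (eq₁ k d) ⟩
  d + (2 * k + 1 + d) + (2 * suc k + 3) ∸ (2 * suc k + 3) ≡⟨ m+n∸n≡m _ (2 * suc k + 3) ⟩
  d + (2 * k + 1 + d)                                     ≡⟨ cong₂ _+_ P∸2k∸3≡d P∸2≡2k+1+d ⟨
  (P ∸ 2 * k ∸ 3) + (P ∸ 2)                               ∎
  where
  open ≡-Reasoning
  P : ℕ
  P = 2 * k + 3 + d
  eq₁ : ∀ k d → 2 * (2 * k + 3 + d) ≡ d + (2 * k + 1 + d) + (2 * suc k + 3)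
  eq₁ = solve-∀
  eq₂ : ∀ k d → 2 * k + 3 + d ≡ 2 * k + 1 + d + 2
  eq₂ = solve-∀
  P∸2k∸3≡d : P ∸ 2 * k ∸ 3 ≡ d
  P∸2k∸3≡d = trans (∸-+-assoc P (2 * k) 3) (m+n∸m≡n (2 * k + 3) d)
  P∸2≡2k+1+d : P ∸ 2 ≡ 2 * k + 1 + d
  P∸2≡2k+1+d = trans (cong (_∸ 2) (eq₂ k d)) (m+n∸n≡m _ 2)

lowerBound-suc : ∀ k → lowerBound (suc k) ≡ lowerBound k + (2 ^ (k + 2) ∸ 2)
lowerBound-suc k = double-∸ k (2k+3≤2^[k+2] k)

suc[2^[k+2]∸2]≡cliqueSize : ∀ k → suc (2 ^ (k + 2) ∸ 2) ≡ cliqueSize k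
suc[2^[k+2]∸2]≡cliqueSize k =
  sym (+-∸-assoc 1 (≤-trans (n≤1+n 2) (≤-trans (m≤n+m 3 (2 * k)) (2k+3≤2^[k+2] k))))

cast-injective : ∀ {m n} (eq : m ≡ n) → Injective _≡_ _≡_ (cast eq)
cast-injective eq {i} {j} e =
  trans (sym (cast-involutive (sym eq) eq i))
        (trans (cong (cast (sym eq)) e) (cast-involutive (sym eq) eq j))

lowerBound≤colour : ∀ k c {n} (f : V k → Fin n) → IsUMColoring (Adj k c) f →
                    ∃ λ v → lowerBound k ≤ colour f v
lowerBound≤colour zero    _       _ _  = tt , s≤s z≤n
lowerBound≤colour (suc k) (c , a) f um
  with knockout seeds (2 ^ (k + 2) ∸ 2) (cast eq) (cast-injective eq)
  where
  open Blocks k c a (connected k c)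
  open Tournament block f um acrossBlocks
  eq : suc (2 ^ (k + 2) ∸ 2) ≡ cliqueSize k
  eq = suc[2^[k+2]∸2]≡cliqueSize k
  seeds : ∀ i → ∃ λ v → block v ≡ i × lowerBound k ≤ colour f v
  seeds i with lowerBound≤colour k c (f ∘ copy i)
                 (isUMColoring-pullback (copy i) (copy-injective i) (copy-edge i) {f = f} um)
  ... | u , bound = copy i u , refl , bound
... | v , _ , bound = v , ≤-trans (≤-reflexive (lowerBound-suc k)) bound

lemma5 : (k : ℕ) (c : Construction k) (n : ℕ) (f : V k → Fin n) →
         IsUMColoring (Adj k c) f → 2 ^ (k + 2) ∸ 2 * k ∸ 3 ≤ n
lemma5 k c n f um with lowerBound≤colour k c f um
... | v , bound = ≤-trans bound (toℕ<n (f v))
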